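{- Let $T$ be an axiomatically appropriate theory and $n\geq 1$. Assume there is a term $d_n$ such that for all formulas $C_1,\dots,C_n$ and all $1\le i\le n$, $T\vdash_{\mathsf{SE}} d_n:(C_i\to C_1\vee\dots\vee C_n)$. Let $A$ be a formula and, for $1\le i\le n$, let $\Gamma_i$ be finite multisets of formulas, all of the same cardinality $m$, such that $T\vdash_{\mathsf{SE}}\bigwedge\Gamma_i\to A$ for each $i$. Then for a variable $x$ there exists a term $q$ such that for each $i$, $T\vdash_{\mathsf{SE}}\bigwedge x:\Gamma_i\to q:A$.
   Context: Syntax of $\mathsf{SE}$: countably infinite sets of justification constants $\mathsf{JConst}=\{0,1,c_1,\dots\}$, variables $\mathsf{JVar}$; terms: constants, variables, $s\cdot t$, $s+t$; formulas: $\bot$, atoms, $A\to B$, $t:A$; $\neg,\wedge,\vee$ abbreviations; the disjunction $C_1\vee\dots\vee C_n$ is taken with one fixed bracketing. $\bigwedge\Gamma$ is the conjunction of the members of the multiset $\Gamma$, and $x:\Gamma=\{x:B\mid B\in\Gamma\}$. $A[w/t]$ replaces the variable $w$ by $t$. Axioms of $\mathsf{SE}$ (for all formulas $A,B$, variables $w,x,y,z$): (CL) propositional tautologies; (j) $x:(A\to B)\to(y:A\to x\cdot y:B)$; (j+) $x:A\wedge y:A\to(x+y):A$; (a+) $A[w/(x+y)+z]\to A[w/x+(y+z)]$; (c+) $A[w/x+y]\to A[w/y+x]$; (0+) $A[w/x+0]\leftrightarrow A[w/x]$; (am) $A[w/(x\cdot y)\cdot z]\leftrightarrow A[w/x\cdot(y\cdot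 z)]$; (a0) $A[w/x\cdot 0]\leftrightarrow A[w/0]$, $A[w/0\cdot x]\leftrightarrow A[w/0]$; (a1) $A[w/x\cdot 1]\leftrightarrow A[w/x]$, $A[w/1\cdot x]\leftrightarrow A[w/x]$; (dl) $A[w/x\cdot(y+z)]\leftrightarrow A[w/x\cdot y+x\cdot z]$; (dr) $A[w/(y+z)\cdot x]\leftrightarrow A[w/y\cdot x+z\cdot x]$. Rules: modus ponens and (jv): from $A$ infer $A[x/t]$. $T\vdash_{\mathsf{SE}}F$: $F$ derivable from axioms and members of the set $T$. $T$ is axiomatically appropriate if for every axiom $A$ there is a constant $c$ with $c:A\in T$, and for every $B\in T$ there is a constant $c$ with $c:B\in T$. -}

module Defs where

open import Data.Nat using (ℕ; zero; suc; _≟_)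
open import Data.Bool using (Bool; true; false; not; _∨_)
open import Data.List using (List; []; _∷_; map)
open import Data.Vec using (Vec; []; _∷_)
open import Data.Product using (Σ; _×_)
open import Relation.Nullary using (yes; no)
open import Relation.Binary.PropositionalEquality using (_≡_)

infixr 6 _·_
infixr 5 _⊕_
infixr 4 _∶_
infixr 3 _⇒_
infix 2 _⇔_
infixr 4 _∧'_ _∨'_
infix 8 _[_/_]

-- Justification terms. Constants are indexed by ℕ: con 0 is the constant 0,
-- con 1 is the constant 1, con (suc (suc i)) are the remaining constants c_i.
-- Variables are indexed by ℕ.
data Term : Set where
  con : ℕ → Term
  var : ℕ → Term
  _·_ : Term → Term → Term
  _⊕_ : Term → Term → Term

𝟘 𝟙 : Term
𝟘 = con 0
𝟙 = con 1

data Fm : Set where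
  ⊥' : Fm
  atom : ℕ → Fm
  _⇒_ : Fm → Fm → Fm
  _∶_ : Term → Fm → Fm

¬' : Fm → Fm
¬' A = A ⇒ ⊥'

⊤' : Fm
⊤' = ¬' ⊥'

_∨'_ : Fm → Fm → Fm
A ∨' B = ¬' A ⇒ B

_∧'_ : Fm → Fm → Fm
A ∧' B = ¬' (A ⇒ ¬' B)

_⇔_ : Fm → Fm → Fm
A ⇔ B = (A ⇒ B) ∧' (B ⇒ A)

-- C_1 ∨ … ∨ C_n, fixed right-nested bracketing (only used for n ≥ 1)
⋁ : ∀ {n} → Vec Fm n → Fm
⋁ [] = ⊥'
⋁ (C ∷ []) = C
⋁ (C ∷ D ∷ Cs) = C ∨' ⋁ (D ∷ Cs)

-- conjunction of a finite multiset (represented as a list), right-nested,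
-- empty conjunction is ⊤
⋀ : List Fm → Fm
⋀ [] = ⊤'
⋀ (B ∷ []) = B
⋀ (B ∷ C ∷ Γ) = B ∧' ⋀ (C ∷ Γ)

_∶∶_ : Term → List Fm → List Fm
x ∶∶ Γ = map (x ∶_) Γ

substT : ℕ → Term → Term → Term
substT w t (con c) = con c
substT w t (var v) with w ≟ v
... | yes _ = t
... | no _ = var v
substT w t (s · u) = substT w t s · substT w t u
substT w t (s ⊕ u) = substT w t s ⊕ substT w t u

_[_/_] : Fm → ℕ → Term → Fm
⊥' [ w / t ] = ⊥'
atom p [ w / t ] = atom p
(A ⇒ B) [ w / t ] = (A [ w / t ]) ⇒ (B [ w / t ])
(s ∶ A) [ w / t ] = substT w t s ∶ (A [ w / t ])

-- propositional tautologies: atoms and justification assertions t:A are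
-- treated as propositional letters
eval : (Fm → Bool) → Fm → Bool
eval v ⊥' = false
eval v (atom p) = v (atom p)
eval v (A ⇒ B) = not (eval v A) ∨ eval v B
eval v (t ∶ A) = v (t ∶ A)

Tautology : Fm → Set
Tautology A = ∀ (v : Fm → Bool) → eval v A ≡ true

data Axiom : Fm → Set where
  CL   : ∀ {A} → Tautology A → Axiom A
  ax-j : ∀ A B x y →
         Axiom ((var x ∶ (A ⇒ B)) ⇒ (var y ∶ A ⇒ (var x · var y) ∶ B))
  ax-j+ : ∀ A x y →
         Axiom ((var x ∶ A) ∧' (var y ∶ A) ⇒ (var x ⊕ var y) ∶ A)
  ax-a+ : ∀ A w x y z →
         Axiom (A [ w / (var x ⊕ var y) ⊕ var z ] ⇒ A [ w / var x ⊕ (var y ⊕ var z) ])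
  ax-c+ : ∀ A w x y →
         Axiom (A [ w / var x ⊕ var y ] ⇒ A [ w / var y ⊕ var x ])
  ax-0+ : ∀ A w x →
         Axiom (A [ w / var x ⊕ 𝟘 ] ⇔ A [ w / var x ])
  ax-am : ∀ A w x y z →
         Axiom (A [ w / (var x · var y) · var z ] ⇔ A [ w / var x · (var y · var z) ])
  ax-a0l : ∀ A w x → Axiom (A [ w / var x · 𝟘 ] ⇔ A [ w / 𝟘 ])
  ax-a0r : ∀ A w x → Axiom (A [ w / 𝟘 · var x ] ⇔ A [ w / 𝟘 ])
  ax-a1l : ∀ A w x → Axiom (A [ w / var x · 𝟙 ] ⇔ A [ w / var x ])
  ax-a1r : ∀ A w x → Axiom (A [ w / 𝟙 · var x ] ⇔ A [ w / var x ])
  ax-dl : ∀ A w x y z →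
         Axiom (A [ w / var x · (var y ⊕ var z) ] ⇔ A [ w / var x · var y ⊕ var x · var z ])
  ax-dr : ∀ A w x y z →
         Axiom (A [ w / (var y ⊕ var z) · var x ] ⇔ A [ w / var y · var x ⊕ var z · var x ])

Theory : Set₁
Theory = Fm → Set

infix 2 _⊢_
data _⊢_ (T : Theory) : Fm → Set where
  axm : ∀ {A} → Axiom A → T ⊢ A
  hyp : ∀ {A} → T A → T ⊢ A
  mp  : ∀ {A B} → T ⊢ A ⇒ B → T ⊢ A → T ⊢ B
  jv  : ∀ {A} x t → T ⊢ A → T ⊢ A [ x / t ]

AxiomaticallyAppropriate : Theory → Set
AxiomaticallyAppropriate T =
  (∀ A → Axiom A → Σ ℕ λ c → T (con c ∶ A)) ×
  (∀ B → T B → Σ ℕ λ c → T (con c ∶ B))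

{-# OPTIONS --safe #-}
-- From ⋀Γᵢ → A for every i, distributivity gives propositionally that A
-- follows from the disjunctions ⋁C over all choice vectors C ∈ Γ₁ × ⋯ × Γₙ.
-- Internalizing this derivation in the axiomatically appropriate T yields a
-- term e with e : ⋁C₁ → ⋯ → ⋁Cₖ → A. Under the hypotheses x:Γᵢ each ⋁C is
-- justified by dₙ·x, since Cᵢ ∈ Γᵢ; hence q = e·(dₙ·x)·⋯·(dₙ·x) works for
-- every i at once.
module Submission where

open import Defs
open import Data.Nat using (ℕ; _≤_; zero; suc; _⊔_; _≟_)
open import Data.Nat.Properties using (m⊔n≤o⇒m≤o; m⊔n≤o⇒n≤o; m≤m⊔n; m≤n⊔m; m≤n⇒m≤1+n; <-irrefl; ≤-refl)
open import Data.Fin using (Fin; zero; suc)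
open import Data.Vec using (Vec; lookup; []; _∷_)
open import Data.List using (List; length; []; _∷_; [_]; map; tabulate; cartesianProductWith)
open import Data.List.Relation.Unary.Any using (Any; here; there)
open import Data.List.Relation.Unary.All as All using (All; []; _∷_)
open import Data.List.Relation.Unary.All.Properties using (tabulate⁺; tabulate⁻)
open import Data.List.Membership.Propositional using (_∈_; find)
open import Data.List.Membership.Propositional.Properties
  using (∈-map⁺; ∈-map⁻; ∈-cartesianProductWith⁺; ∈-cartesianProductWith⁻)
open import Data.Product using (Σ; ∃; _×_; _,_)
open import Data.Bool as Bool using (Bool; true; false)
open import Data.Empty using (⊥-elim)
open import Data.Sum using (_⊎_; inj₁; inj₂; [_,_]′)
open import Function using (_∘_)
open import Relation.Nullary using (¬_; Dec; yes; no)
open import Relation.Nullary.Decidable using (decidable-stable; map′)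
open import Relation.Binary.PropositionalEquality using (_≡_; refl; cong₂; subst)

freshFromᵀ : Term → ℕ
freshFromᵀ (con _) = 0
freshFromᵀ (var v) = suc v
freshFromᵀ (s · u) = freshFromᵀ s ⊔ freshFromᵀ u
freshFromᵀ (s ⊕ u) = freshFromᵀ s ⊔ freshFromᵀ u

freshFrom : Fm → ℕ
freshFrom ⊥' = 0
freshFrom (atom _) = 0
freshFrom (A ⇒ B) = freshFrom A ⊔ freshFrom B
freshFrom (t ∶ A) = freshFromᵀ t ⊔ freshFrom A

substT-var-≢ : ∀ {w v} t → ¬ w ≡ v → substT w t (var v) ≡ var v
substT-var-≢ {w} {v} t w≢v with w ≟ v
... | yes w≡v = ⊥-elim (w≢v w≡v)
... | no _ = refl

substT-var-≡ : ∀ w t → substT w t (var w) ≡ t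
substT-var-≡ w t with w ≟ w
... | yes _ = refl
... | no w≢w = ⊥-elim (w≢w refl)

substT-fresh : ∀ {w} t u → freshFromᵀ u ≤ w → substT w t u ≡ u
substT-fresh t (con c) _ = refl
substT-fresh t (var v) v<w = substT-var-≢ t λ { refl → <-irrefl refl v<w }
substT-fresh t (s · u) le =
  cong₂ _·_ (substT-fresh t s (m⊔n≤o⇒m≤o _ _ le)) (substT-fresh t u (m⊔n≤o⇒n≤o _ _ le))
substT-fresh t (s ⊕ u) le =
  cong₂ _⊕_ (substT-fresh t s (m⊔n≤o⇒m≤o _ _ le)) (substT-fresh t u (m⊔n≤o⇒n≤o _ _ le))

subst-fresh : ∀ {w} t A → freshFrom A ≤ w → A [ w / t ] ≡ A
subst-fresh t ⊥' _ = refl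
subst-fresh t (atom _) _ = refl
subst-fresh t (A ⇒ B) le =
  cong₂ _⇒_ (subst-fresh t A (m⊔n≤o⇒m≤o _ _ le)) (subst-fresh t B (m⊔n≤o⇒n≤o _ _ le))
subst-fresh t (s ∶ A) le =
  cong₂ _∶_ (substT-fresh t s (m⊔n≤o⇒m≤o _ _ le)) (subst-fresh t A (m⊔n≤o⇒n≤o _ _ le))

infix 2.5 _⊨_

record _⊨_ (v : Fm → Bool) (A : Fm) : Set where
  constructor sat
  field holds : eval v A ≡ true

open _⊨_

module _ {v : Fm → Bool} where

  _⊨?_ : ∀ A → Dec (v ⊨ A)
  _⊨?_ A = map′ sat holds (eval v A Bool.≟ true)

  ⊨-stable : ∀ {A} → ¬ ¬ (v ⊨ A) → v ⊨ A
  ⊨-stable {A} = decidable-stable (_⊨?_ A)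

  ⊭⊥ : ¬ (v ⊨ ⊥')
  ⊭⊥ (sat ())

  ⊨-⇒ : ∀ {A B} → (v ⊨ A → v ⊨ B) → v ⊨ A ⇒ B
  ⊨-⇒ {A} {B} f = sat (by-cases (eval v A) refl)
    where
    by-cases : ∀ b → eval v A ≡ b → Bool.not b Bool.∨ eval v B ≡ true
    by-cases true ⊨A = holds (f (sat ⊨A))
    by-cases false _ = refl

  ⊨-mp : ∀ {A B} → v ⊨ A ⇒ B → v ⊨ A → v ⊨ B
  ⊨-mp {A} (sat ⊨A⇒B) (sat ⊨A) rewrite ⊨A = sat ⊨A⇒B

  ⊨-¬ : ∀ {A} → ¬ (v ⊨ A) → v ⊨ ¬' A
  ⊨-¬ ⊭A = ⊨-⇒ (⊥-elim ∘ ⊭A)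

  ⊨-∧ : ∀ {A B} → v ⊨ A → v ⊨ B → v ⊨ A ∧' B
  ⊨-∧ ⊨A ⊨B = ⊨-⇒ λ ⊨A⇒¬B → ⊨-mp (⊨-mp ⊨A⇒¬B ⊨A) ⊨B

  ⊭-∧ : ∀ {A B} → ¬ (v ⊨ A ∧' B) → ¬ (v ⊨ A) ⊎ ¬ (v ⊨ B)
  ⊭-∧ {A} ⊭A∧B with _⊨?_ A
  ... | yes ⊨A = inj₂ (⊭A∧B ∘ ⊨-∧ ⊨A)
  ... | no ⊭A = inj₁ ⊭A

  ⊨-∧ˡ : ∀ {A B} → v ⊨ A ∧' B → v ⊨ A
  ⊨-∧ˡ ⊨A∧B = ⊨-stable λ ⊭A → ⊭⊥ (⊨-mp ⊨A∧B (⊨-⇒ (⊥-elim ∘ ⊭A)))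

  ⊨-∧ʳ : ∀ {A B} → v ⊨ A ∧' B → v ⊨ B
  ⊨-∧ʳ ⊨A∧B = ⊨-stable λ ⊭B → ⊭⊥ (⊨-mp ⊨A∧B (⊨-⇒ λ _ → ⊨-¬ ⊭B))

  ⊨-⋀⁻ : ∀ Γ {B} → v ⊨ ⋀ Γ → B ∈ Γ → v ⊨ B
  ⊨-⋀⁻ (B ∷ []) ⊨B (here refl) = ⊨B
  ⊨-⋀⁻ (B ∷ C ∷ Γ) ⊨∧ (here refl) = ⊨-∧ˡ ⊨∧
  ⊨-⋀⁻ (B ∷ C ∷ Γ) ⊨∧ (there D∈) = ⊨-⋀⁻ (C ∷ Γ) (⊨-∧ʳ ⊨∧) D∈

  ⊭-⋀ : ∀ Γ → ¬ (v ⊨ ⋀ Γ) → Any (¬_ ∘ (v ⊨_)) Γ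
  ⊭-⋀ [] ⊭⊤ = ⊥-elim (⊭⊤ (⊨-¬ ⊭⊥))
  ⊭-⋀ (B ∷ []) ⊭B = here ⊭B
  ⊭-⋀ (B ∷ C ∷ Γ) ⊭∧ = [ here , there ∘ ⊭-⋀ (C ∷ Γ) ]′ (⊭-∧ ⊭∧)

  ⊭-⋁ : ∀ {k} (C : Vec Fm k) → (∀ i → ¬ (v ⊨ lookup C i)) → ¬ (v ⊨ ⋁ C)
  ⊭-⋁ [] _ = ⊭⊥
  ⊭-⋁ (C ∷ []) ⊭C = ⊭C zero
  ⊭-⋁ (C ∷ D ∷ Cs) ⊭C ⊨⋁ = ⊭-⋁ (D ∷ Cs) (⊭C ∘ suc) (⊨-mp ⊨⋁ (⊨-¬ (⊭C zero)))

infixr 3 _⇒*_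

_⇒*_ : List Fm → Fm → Fm
[] ⇒* Q = Q
(P ∷ Ps) ⇒* Q = P ⇒ Ps ⇒* Q

⊨-⇒* : ∀ {v} Ps {Q} → (All (v ⊨_) Ps → v ⊨ Q) → v ⊨ Ps ⇒* Q
⊨-⇒* [] f = f []
⊨-⇒* (P ∷ Ps) f = ⊨-⇒ λ ⊨P → ⊨-⇒* Ps (f ∘ (⊨P ∷_))

choices : ∀ {a} {A : Set a} {n} → (Fin n → List A) → List (Vec A n)
choices {n = zero} Γ = [ [] ]
choices {n = suc n} Γ = cartesianProductWith _∷_ (Γ zero) (choices (Γ ∘ suc))

module _ {a} {A : Set a} where

  ∈-choices⁻ : ∀ {n} {Γ : Fin n → List A} {C} → C ∈ choices Γ → ∀ i → lookup C i ∈ Γ i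
  ∈-choices⁻ {suc n} {Γ} C∈ i
    with B , Cs , B∈ , Cs∈ , refl ← ∈-cartesianProductWith⁻ _∷_ (Γ zero) (choices (Γ ∘ suc)) C∈
    with i
  ... | zero = B∈
  ... | suc j = ∈-choices⁻ Cs∈ j

  choose : ∀ {p} {P : A → Set p} {n} (Γ : Fin n → List A) →
           (∀ i → Any P (Γ i)) → ∃ λ C → C ∈ choices Γ × ∀ i → P (lookup C i)
  choose {n = zero} Γ _ = [] , here refl , λ ()
  choose {n = suc n} Γ witness =
    let B , B∈ , PB = find (witness zero)
        Cs , Cs∈ , PCs = choose (Γ ∘ suc) (witness ∘ suc)
    in B ∷ Cs , ∈-cartesianProductWith⁺ _∷_ B∈ Cs∈ , λ { zero → PB ; (suc i) → PCs i }

-- If A fails, pick a failing member of every Γ i; their disjunction fails too.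
distribution-tautology : ∀ {n} (Γ : Fin n → List Fm) A →
  ∀ v → v ⊨ tabulate (λ i → ⋀ (Γ i) ⇒ A) ⇒* map ⋁ (choices Γ) ⇒* A
distribution-tautology Γ A v =
  ⊨-⇒* (tabulate _) λ ⊨Γ⇒A → ⊨-⇒* (map ⋁ (choices Γ)) λ ⊨⋁s → ⊨-stable λ ⊭A →
    let C , C∈ , ⊭C = choose Γ λ i → ⊭-⋀ (Γ i) (⊭A ∘ ⊨-mp (tabulate⁻ ⊨Γ⇒A i))
    in ⊭-⋁ C ⊭C (All.lookup ⊨⋁s (∈-map⁺ ⋁ C∈))

module _ {T : Theory} where

  ⊢-valid : ∀ {A} → (∀ v → v ⊨ A) → T ⊢ A
  ⊢-valid valid = axm (CL (holds ∘ valid))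

  -- (j) only speaks about variables: instantiate it at two variables fresh
  -- for s, P and Q, so that substituting s and then r changes nothing else.
  ⊢-j : ∀ s r P Q → T ⊢ s ∶ (P ⇒ Q) ⇒ r ∶ P ⇒ (s · r) ∶ Q
  ⊢-j s r P Q = subst (T ⊢_) instantiate (jv y r (jv x s (axm (ax-j P Q x y))))
    where
    x y : ℕ
    x = freshFrom (P ⇒ Q) ⊔ freshFromᵀ s
    y = suc x
    x≢y : ¬ x ≡ y
    x≢y x≡y = <-irrefl x≡y ≤-refl
    P⇒Q≤x : freshFrom (P ⇒ Q) ≤ x
    P⇒Q≤x = m≤m⊔n _ _
    P≤x : freshFrom P ≤ x
    P≤x = m⊔n≤o⇒m≤o _ _ P⇒Q≤x
    Q≤x : freshFrom Q ≤ x
    Q≤x = m⊔n≤o⇒n≤o _ _ P⇒Q≤x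
    s≤x : freshFromᵀ s ≤ x
    s≤x = m≤n⊔m _ _
    instantiate : ((var x ∶ (P ⇒ Q) ⇒ var y ∶ P ⇒ (var x · var y) ∶ Q) [ x / s ]) [ y / r ]
                  ≡ (s ∶ (P ⇒ Q) ⇒ r ∶ P ⇒ (s · r) ∶ Q)
    instantiate
      rewrite substT-var-≡ x s | substT-var-≢ s x≢y
            | subst-fresh s P P≤x | subst-fresh s Q Q≤x
            | substT-var-≡ y r | substT-fresh r s (m≤n⇒m≤1+n s≤x)
            | subst-fresh r P (m≤n⇒m≤1+n P≤x) | subst-fresh r Q (m≤n⇒m≤1+n Q≤x)
      = refl

  mp-under : ∀ {H P Q} → T ⊢ H ⇒ P ⇒ Q → T ⊢ H ⇒ P → T ⊢ H ⇒ Q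
  mp-under ⊢H⇒P⇒Q ⊢H⇒P = mp (mp (⊢-valid λ _ → distribute) ⊢H⇒P⇒Q) ⊢H⇒P
    where
    distribute : ∀ {v H P Q} → v ⊨ (H ⇒ P ⇒ Q) ⇒ (H ⇒ P) ⇒ H ⇒ Q
    distribute = ⊨-⇒ λ ⊨H⇒P⇒Q → ⊨-⇒ λ ⊨H⇒P → ⊨-⇒ λ ⊨H → ⊨-mp (⊨-mp ⊨H⇒P⇒Q ⊨H) (⊨-mp ⊨H⇒P ⊨H)

  weaken : ∀ {H P} → T ⊢ P → T ⊢ H ⇒ P
  weaken = mp (⊢-valid λ _ → ⊨-⇒ λ ⊨P → ⊨-⇒ λ _ → ⊨P)

  app-under : ∀ {H s r P Q} → T ⊢ H ⇒ s ∶ (P ⇒ Q) → T ⊢ H ⇒ r ∶ P → T ⊢ H ⇒ (s · r) ∶ Q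
  app-under {s = s} {r} {P} {Q} ⊢s ⊢r = mp-under (mp-under (weaken (⊢-j s r P Q)) ⊢s) ⊢r

  ⊢-⋀-proj : ∀ {Γ B} → B ∈ Γ → T ⊢ ⋀ Γ ⇒ B
  ⊢-⋀-proj {Γ} B∈ = ⊢-valid λ _ → ⊨-⇒ λ ⊨Γ → ⊨-⋀⁻ Γ ⊨Γ B∈

  mp* : ∀ {Ps Q} → T ⊢ Ps ⇒* Q → All (T ⊢_) Ps → T ⊢ Q
  mp* ⊢Q [] = ⊢Q
  mp* ⊢Ps⇒Q (⊢P ∷ ⊢Ps) = mp* (mp ⊢Ps⇒Q ⊢P) ⊢Ps

  internalization : AxiomaticallyAppropriate T → ∀ {F} → T ⊢ F → ∃ λ t → T ⊢ t ∶ F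
  internalization (axioms , _) (axm {A} ax) = let c , ⊢c = axioms A ax in con c , hyp ⊢c
  internalization (_ , members) (hyp {B} B∈T) = let c , ⊢c = members B B∈T in con c , hyp ⊢c
  internalization aa (mp {A} {B} ⊢A⇒B ⊢A) =
    let s , ⊢s = internalization aa ⊢A⇒B
        r , ⊢r = internalization aa ⊢A
    in s · r , mp (mp (⊢-j s r A B) ⊢s) ⊢r
  internalization aa (jv x u ⊢A) = let t , ⊢t = internalization aa ⊢A in substT x u t , jv x u ⊢t

infixl 6 _·[_]^_

_·[_]^_ : Term → Term → ℕ → Term
t ·[ s ]^ zero = t
t ·[ s ]^ suc k = (t · s) ·[ s ]^ k

app*-under : ∀ {T H t s A} Ps → T ⊢ H ⇒ t ∶ (Ps ⇒* A) →
             (∀ {F} → F ∈ Ps → T ⊢ H ⇒ s ∶ F) → T ⊢ H ⇒ (t ·[ s ]^ length Ps) ∶ A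
app*-under [] ⊢t _ = ⊢t
app*-under (P ∷ Ps) ⊢t ⊢s = app*-under Ps (app-under ⊢t (⊢s (here refl))) (⊢s ∘ there)

mainTheorem18 : (T : Theory) → AxiomaticallyAppropriate T →
    (n : ℕ) → 1 ≤ n →
    (dₙ : Term) →
    (∀ (C : Vec Fm n) (i : Fin n) → T ⊢ dₙ ∶ (lookup C i ⇒ ⋁ C)) →
    (A : Fm) (m : ℕ) (Γ : Fin n → List Fm) →
    (∀ i → length (Γ i) ≡ m) →
    (∀ i → T ⊢ ⋀ (Γ i) ⇒ A) →
    (x : ℕ) →
    Σ Term λ q → ∀ (i : Fin n) → T ⊢ ⋀ (var x ∶∶ Γ i) ⇒ q ∶ A
mainTheorem18 T aa n _ dₙ ⊢dₙ A m Γ _ ⊢Γ⇒A x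
  with e , ⊢e ← internalization aa (mp* (⊢-valid (distribution-tautology Γ A)) (tabulate⁺ ⊢Γ⇒A))
  = e ·[ dₙ · var x ]^ length disjunctions ,
    λ i → app*-under disjunctions (weaken ⊢e) (⊢dₙx i)
  where
  disjunctions : List Fm
  disjunctions = map ⋁ (choices Γ)
  ⊢dₙx : ∀ i {F} → F ∈ disjunctions → T ⊢ ⋀ (var x ∶∶ Γ i) ⇒ (dₙ · var x) ∶ F
  ⊢dₙx i F∈ with C , C∈ , refl ← ∈-map⁻ ⋁ F∈ =
    app-under (weaken (⊢dₙ C i)) (⊢-⋀-proj (∈-map⁺ (var x ∶_) (∈-choices⁻ C∈ i)))
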